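{- Let $\varphi\in\mathcal{L}$. If $M^\circ_{P'}\models[\leftleftarrows]\varphi$ for every $P'\subseteq P$, then $\varphi$ is valid.
   Context: Fix a non-empty countable set $P$ of propositional variables and a non-empty finite set $A$ of agents. The language $\mathcal{L}$ is $\varphi ::= p \mid \neg\varphi \mid (\varphi\wedge\varphi) \mid \Box_a\varphi \mid [\leftleftarrows]\varphi \mid [\rightrightarrows]\varphi \mid [\circ]\varphi$ ($p\in P$, $a\in A$). A model is $M=(S,R,V)$ with $S$ non-empty countable, $R_a\subseteq S\times S$ for each $a\in A$, $V:S\to\mathcal{P}(P)$. For models $M=(S,R,V)$, $M'=(S',R',V')$, a non-empty $Z\subseteq S\times S'$ is a simulation if for all $(s,s')\in Z$, $a\in A$: $V(s)=V'(s')$ and (forth) if $R_a st$ then some $t'$ has $R'_a s't'$ and $(t,t')\in Z$; it is a refinement if $V(s)=V'(s')$ and (back) if $R'_a s't'$ then some $t$ has $R_a st$ and $(t,t')\in Z$. $M_s\rightrightarrows M'_{s'}$ / $M_s\leftleftarrows M'_{s'}$: there is a simulation / refinement containing $(s,s')$. The mutual factual ignorance model $M^\circ=(S^\circ,R^\circ,V^\circ)$: $S^\circ=\mathcal{P}(P)$, $R^\circ_a=S^\circ\times S^\circ$, $V^\circ(s)=s$. Semantics: $M_s\models p$ iff $p\in V(s)$; Boolean clauses as usual; $M_s\models\Box_a\varphi$ iff $M_t\models\varphi$ for all $(s,t)\in R_a$; $M_s\models[\leftleftarrows]\varphi$ iff $M'_{s'}\models\varphi$ for all $M'_{s'}$ with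 $M_s\leftleftarrows M'_{s'}$; $M_s\models[\rightrightarrows]\varphi$ iff $M'_{s'}\models\varphi$ for all $M'_{s'}$ with $M_s\rightrightarrows M'_{s'}$; $M_s\models[\circ]\varphi$ iff $M^\circ_{V(s)}\models\varphi$. Valid means true at every pointed model $M_s$. -}

module Defs where

open import Level using (Level; Lift; lift) renaming (zero to lzero; suc to lsuc)
open import Data.Nat using (ℕ)
open import Data.Fin using (Fin)
open import Data.Bool using (Bool; true)
open import Data.Unit using (⊤)
open import Data.Product using (Σ; ∃; _×_; _,_)
open import Relation.Nullary using (¬_)
open import Relation.Binary.PropositionalEquality using (_≡_)
open import Function.Definitions using (Injective)
open import Function.Bundles using (_↔_)

Countable : Set → Set
Countable X = Σ (X → ℕ) (Injective _≡_ _≡_)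

Finite : Set → Set
Finite X = ∃ λ n → Fin n ↔ X

module Logic (P : Set) (A : Set) where

  data Form : Set where
    atom  : P → Form
    ¬'_   : Form → Form
    _∧'_  : Form → Form → Form
    □     : A → Form → Form
    [⇇]   : Form → Form
    [⇉]   : Form → Form
    [∘]   : Form → Form

  Subset : Set
  Subset = P → Bool

  -- Kripke structures (no countability requirement); needed since M∘ has
  -- carrier 𝒫(P), which need not be countable.
  record Structure : Set₁ where
    field
      S : Set
      R : A → S → S → Set
      V : S → Subset
  open Structure public

  record Model : Set₁ where
    field
      struct   : Structure
      point    : S struct
      countable : Countable (S struct)
  open Model public

  SameVal : Subset → Subset → Set
  SameVal X Y = ∀ p → X p ≡ Y p

  IsSimulation : (M M' : Structure) → (S M → S M' → Set) → Set
  IsSimulation M M' Z =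
    (∃ λ s → ∃ λ s' → Z s s') ×
    (∀ s s' → Z s s' →
       SameVal (V M s) (V M' s') ×
       (∀ a t → R M a s t → ∃ λ t' → R M' a s' t' × Z t t'))

  IsRefinement : (M M' : Structure) → (S M → S M' → Set) → Set
  IsRefinement M M' Z =
    (∃ λ s → ∃ λ s' → Z s s') ×
    (∀ s s' → Z s s' →
       SameVal (V M s) (V M' s') ×
       (∀ a t' → R M' a s' t' → ∃ λ t → R M a s t × Z t t'))

  _,_⇉_,_ : (M : Structure) → S M → (M' : Structure) → S M' → Set₁
  M , s ⇉ M' , s' = Σ (S M → S M' → Set) λ Z → IsSimulation M M' Z × Z s s'

  _,_⇇_,_ : (M : Structure) → S M → (M' : Structure) → S M' → Set₁
  M , s ⇇ M' , s' = Σ (S M → S M' → Set) λ Z → IsRefinement M M' Z × Z s s'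

  M∘ : Structure
  M∘ = record { S = Subset ; R = λ _ _ _ → ⊤ ; V = λ s → s }

  _,_⊨_ : (M : Structure) → S M → Form → Set₁
  M , s ⊨ atom p   = Lift _ (V M s p ≡ true)
  M , s ⊨ (¬' φ)   = ¬ (M , s ⊨ φ)
  M , s ⊨ (φ ∧' ψ) = (M , s ⊨ φ) × (M , s ⊨ ψ)
  M , s ⊨ □ a φ    = ∀ t → R M a s t → M , t ⊨ φ
  M , s ⊨ [⇇] φ    = ∀ (M' : Model) (s' : S (struct M')) →
                       M , s ⇇ struct M' , s' → struct M' , s' ⊨ φ
  M , s ⊨ [⇉] φ    = ∀ (M' : Model) (s' : S (struct M')) →
                       M , s ⇉ struct M' , s' → struct M' , s' ⊨ φ
  M , s ⊨ [∘] φ    = M∘ , V M s ⊨ φ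

  Valid : Form → Set₁
  Valid φ = ∀ (M : Model) (s : S (struct M)) → struct M , s ⊨ φ

{-# OPTIONS --safe #-}
module Submission where

open import Defs
open import Data.Bool using (Bool)
open import Data.Unit using (tt)
open import Data.Product using (_,_)
open import Relation.Binary.PropositionalEquality using (refl)

module _ (P : Set) (A : Set) where
  open Logic P A

  SameValAs : (M : Structure) → Subset → S M → Set
  SameValAs M u t = SameVal u (V M t)

  -- Back holds trivially: in M∘ every agent considers every valuation possible.
  sameVal-isRefinement : (M : Structure) → S M → IsRefinement M∘ M (SameValAs M)
  sameVal-isRefinement M s =
    (V M s , s , λ _ → refl) , λ u t u≡Vt → u≡Vt , λ a t' _ → V M t' , tt , λ _ → refl

  M∘-⇇ : (M : Structure) (s : S M) → M∘ , V M s ⇇ M , s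
  M∘-⇇ M s = SameValAs M , sameVal-isRefinement M s , λ _ → refl

proposition4 : (P : Set) → Countable P → P →
    (A : Set) → Finite A → A →
    (φ : Logic.Form P A) →
    ((P' : P → Bool) → Logic._,_⊨_ P A (Logic.M∘ P A) P' (Logic.[⇇] φ)) →
    Logic.Valid P A φ
-- The hypotheses on P and A are unused: every pointed model refines M∘ at its own valuation.
proposition4 P _ _ A _ _ φ M∘⊨[⇇]φ M s =
  M∘⊨[⇇]φ (V (struct M) s) M s (M∘-⇇ P A (struct M) s)
  where open Logic P A
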